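{- Let $(M,\nu,\mathfrak{e})$ be a monoid (in the category $\mathbf{Sp}$ of species with the product), and $(\mathscr{O},\eta,e)$ an operad (a monoid in the category $\mathbf{Sp}_+$ of positive species with substitution), $M$ being a right $\mathscr{O}$-module with action $\tau:M(\mathscr{O})\rightarrow M$. If $\tau$ and $\nu$ are compatible then the pair $(M,\mathscr{O})$, $(M,\mathscr{O})=((M,\mathscr{O}),(\rho,\eta), (\mathfrak{e},e))$, with $\rho:=\nu\circ (M.\tau)$ is a monop. Conversely, if $(M,\mathscr{O})=((M,\mathscr{O}),(\rho,\eta), (\mathfrak{e},e))$ is a monop, then $(\mathscr{O},\eta,e)$ is an operad, $(M,\nu,\mathfrak{e})$, with $\nu=\rho\circ (M.M(e))$, is a monoid with a structure of right $\mathscr{O}$-module $\tau=\rho\circ(\mathfrak{e}\cdot M(\mathscr{O}))$, and $\nu$ and $\tau$ are compatible.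
   Context: Species are functors from finite sets and bijections to sets (or vector spaces). The product of species is $(M.N)[V]=\sum_{V_1+V_2=V}M[V_1]\times N[V_2]$, with identity the species $1$ (concentrated on the empty set); the substitution of a positive species $P$ ($P[\emptyset]=\emptyset$) into $R$ is $R(P)[V]=\sum_{\pi\in\Pi[V]}\prod_{B\in\pi}P[B]\times R[\pi]$, with identity the singleton species $X$. The Riordan category $\mathbf{Sp}\rtimes\mathbf{Sp}_+$ has as objects pairs $(M,\mathscr{O})$ with $\mathscr{O}$ positive, monoidal product $(M_1,\mathscr{O}_1)\ast (M_2,\mathscr{O}_2)=(M_1.M_2(\mathscr{O}_1),\mathscr{O}_2(\mathscr{O}_1))$ and identity $(1,X)$. A monop is a monoid in this category: a pair $(M,\mathscr{O})$ with product $(\rho,\eta):(M,\mathscr{O})\ast(M,\mathscr{O})\rightarrow(M,\mathscr{O})$, i.e. $\rho:M.M(\mathscr{O})\rightarrow M$ and $\eta:\mathscr{O}(\mathscr{O})\rightarrow\mathscr{O}$, and identity $(\mathfrak{e},e):(1,X)\rightarrow(M,\mathscr{O})$, satisfying the monoid identity and associativity axioms. $M$ is a right $\mathscr{O}$-module if there is $\tau:M(\mathscr{O})\rightarrow M$ that is pseudo-associative, $\tau(\bar{\eta}(a_1,a_2),m_{\pi})=\tau(a_1,\tau(a_2,m_{\pi}))$, and such that the assembly of operad identities fixes every structure, $\tau(\{e_v\}_{v\in V},m_V)=m_V$. For a monoid $(M,\nu,\mathfrak{e})$ that is also a right $\mathscr{O}$-module, $\nu$ and $\tau$ are compatible if for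 every pair $((a_{V_1},m_{\pi_1}),(a_{V_2},m_{\pi_2}))\in M(\mathscr{O})[V_1]\times M(\mathscr{O})[V_2]$ one has $\nu(\tau(a_{V_1},m_{\pi_1}),\tau(a_{V_2},m_{\pi_2}))=\tau(a_{V_1}\sqcup a_{V_2},\nu(m_{\pi_1},m_{\pi_2}))$ (diagrammatically, $\nu\circ(\tau.\tau)=\tau\circ\nu(\mathscr{O})\circ\beta$, with $\beta:M(\mathscr{O}).M(\mathscr{O})\rightarrow(M.M)(\mathscr{O})$ the canonical isomorphism). -}

module Defs where

open import Data.Empty using (⊥)
open import Data.Unit using (⊤; tt)
open import Data.Sum using (_⊎_; inj₁; inj₂; [_,_])
open import Data.Product using (Σ; _,_; proj₁; proj₂; uncurry; _×_)
open import Data.List as L using (List; []; _∷_; _++_; concatMap)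
open import Data.List.Relation.Unary.Any using (here)
import Data.List.Relation.Unary.Any as Any
open import Data.List.Membership.Propositional using (_∈_)
open import Data.List.Membership.Propositional.Properties
  using (∈-map⁺; ∈-++⁺ˡ; ∈-++⁺ʳ; ∈-concatMap⁺)
open import Function using (_∘_; const; id)
open import Function.Bundles using (_↔_; Inverse; mk↔ₛ′)
open import Function.Construct.Identity using (↔-id)
open import Function.Construct.Composition using (_↔-∘_)
open import Data.Sum.Function.Propositional using (_⊎-↔_)
open import Data.Product.Function.Dependent.Propositional using (Σ-↔)
open import Relation.Binary.PropositionalEquality using (_≡_; refl)

-- Finite sets.  A finite set is a type together with a finite list
-- enumerating all of its elements (classically: exactly the finite sets).

record FinSet : Set₁ where
  field
    Carrier  : Set
    elems    : List Carrier
    complete : ∀ x → x ∈ elems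
open FinSet public

record _≅_ (V W : FinSet) : Set where
  constructor bij
  field
    iso : Carrier V ↔ Carrier W
open _≅_ public

to : ∀ {V W} → V ≅ W → Carrier V → Carrier W
to σ = Inverse.to (iso σ)

idᵇ : ∀ V → V ≅ V
idᵇ V = bij (↔-id (Carrier V))

_∘ᵇ_ : ∀ {U V W} → V ≅ W → U ≅ V → U ≅ W
σ′ ∘ᵇ σ = bij (iso σ′ ↔-∘ iso σ)



∅ₛ : FinSet
∅ₛ = record { Carrier = ⊥ ; elems = [] ; complete = λ () }

𝟙ₛ : FinSet
𝟙ₛ = record { Carrier = ⊤ ; elems = tt ∷ [] ; complete = λ _ → here refl }

_⊎ₛ_ : FinSet → FinSet → FinSet
V ⊎ₛ W = record
  { Carrier  = Carrier V ⊎ Carrier W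
  ; elems    = L.map inj₁ (elems V) ++ L.map inj₂ (elems W)
  ; complete = λ { (inj₁ v) → ∈-++⁺ˡ (∈-map⁺ inj₁ (complete V v))
                 ; (inj₂ w) → ∈-++⁺ʳ (L.map inj₁ (elems V)) (∈-map⁺ inj₂ (complete W w)) }
  }

Σₛ : (P : FinSet) → (Carrier P → FinSet) → FinSet
Σₛ P B = record
  { Carrier  = Σ (Carrier P) (λ p → Carrier (B p))
  ; elems    = concatMap (λ p → L.map (p ,_) (elems (B p))) (elems P)
  ; complete = λ { (p , b) → ∈-concatMap⁺ (λ q → L.map (q ,_) (elems (B q))) (Any.map (λ { refl → ∈-map⁺ (p ,_) (complete (B p) b) })
                                                  (complete P p)) }
  }

_⊎ᵇ_ : ∀ {V V′ W W′} → V ≅ V′ → W ≅ W′ → (V ⊎ₛ W) ≅ (V′ ⊎ₛ W′)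
α ⊎ᵇ β = bij (iso α ⊎-↔ iso β)

[_,_]ᶠ : ∀ {P₁ P₂ : FinSet} → (Carrier P₁ → FinSet) → (Carrier P₂ → FinSet)
       → Carrier (P₁ ⊎ₛ P₂) → FinSet
[ B₁ , B₂ ]ᶠ (inj₁ p) = B₁ p
[ B₁ , B₂ ]ᶠ (inj₂ p) = B₂ p

uncurryᶠ : ∀ {P : FinSet} {Q : Carrier P → FinSet}
         → ((p : Carrier P) → Carrier (Q p) → FinSet) → Carrier (Σₛ P Q) → FinSet
uncurryᶠ R (p , q) = R p q

emptyFam : Carrier ∅ₛ → FinSet
emptyFam ()

-- Species: functors from finite sets and bijections to sets.
-- (tr-cong: bijections are compared extensionally, as in set theory.)

record Species : Set₁ where
  field
    Str     : FinSet → Set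
    tr      : ∀ {V W} → V ≅ W → Str V → Str W
    tr-cong : ∀ {V W} (σ σ′ : V ≅ W) → (∀ v → to σ v ≡ to σ′ v)
            → ∀ x → tr σ x ≡ tr σ′ x
    tr-id   : ∀ {V} (x : Str V) → tr (idᵇ V) x ≡ x
    tr-∘    : ∀ {U V W} (σ : U ≅ V) (σ′ : V ≅ W) (x : Str U)
            → tr (σ′ ∘ᵇ σ) x ≡ tr σ′ (tr σ x)
open Species public

Positive : Species → Set₁
Positive O = ∀ V → (Carrier V → ⊥) → Str O V → ⊥

-- an assembly of O-structures on the blocks B p of a partition indexed by P
Assembly : Species → (P : FinSet) → (Carrier P → FinSet) → Set
Assembly O P B = (p : Carrier P) → Str O (B p)

asm⊎ : ∀ (O : Species) {P₁ P₂ B₁ B₂} → Assembly O P₁ B₁ → Assembly O P₂ B₂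
     → Assembly O (P₁ ⊎ₛ P₂) ([_,_]ᶠ {P₁} {P₂} B₁ B₂)
asm⊎ O a₁ a₂ (inj₁ p) = a₁ p
asm⊎ O a₁ a₂ (inj₂ p) = a₂ p

asmΣ : ∀ (O : Species) {P : FinSet} {Q : Carrier P → FinSet}
         {R : (p : Carrier P) → Carrier (Q p) → FinSet}
     → ((p : Carrier P) (q : Carrier (Q p)) → Str O (R p q))
     → Assembly O (Σₛ P Q) (uncurryᶠ {P} {Q} R)
asmΣ O c (p , q) = c p q

emptyAsm : ∀ (O : Species) → Assembly O ∅ₛ emptyFam
emptyAsm O ()

constAsm : ∀ (O : Species) (P : FinSet) → Str O 𝟙ₛ → Assembly O P (λ _ → 𝟙ₛ)
constAsm O P e _ = e

⊎-assocᵇ : ∀ U V W → ((U ⊎ₛ V) ⊎ₛ W) ≅ (U ⊎ₛ (V ⊎ₛ W))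
⊎-assocᵇ U V W = bij (mk↔ₛ′ f g fg gf)
  where
  f : Carrier ((U ⊎ₛ V) ⊎ₛ W) → Carrier (U ⊎ₛ (V ⊎ₛ W))
  f (inj₁ (inj₁ u)) = inj₁ u
  f (inj₁ (inj₂ v)) = inj₂ (inj₁ v)
  f (inj₂ w)        = inj₂ (inj₂ w)
  g : Carrier (U ⊎ₛ (V ⊎ₛ W)) → Carrier ((U ⊎ₛ V) ⊎ₛ W)
  g (inj₁ u)        = inj₁ (inj₁ u)
  g (inj₂ (inj₁ v)) = inj₁ (inj₂ v)
  g (inj₂ (inj₂ w)) = inj₂ w
  fg : ∀ y → f (g y) ≡ y
  fg (inj₁ u)        = refl
  fg (inj₂ (inj₁ v)) = refl
  fg (inj₂ (inj₂ w)) = refl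
  gf : ∀ x → g (f x) ≡ x
  gf (inj₁ (inj₁ u)) = refl
  gf (inj₁ (inj₂ v)) = refl
  gf (inj₂ w)        = refl

unitˡᵇ : ∀ V → (∅ₛ ⊎ₛ V) ≅ V
unitˡᵇ V = bij (mk↔ₛ′ f inj₂ (λ _ → refl) gf)
  where
  f : Carrier (∅ₛ ⊎ₛ V) → Carrier V
  f (inj₂ v) = v
  gf : ∀ x → inj₂ (f x) ≡ x
  gf (inj₂ v) = refl

unitʳᵇ : ∀ V → (V ⊎ₛ ∅ₛ) ≅ V
unitʳᵇ V = bij (mk↔ₛ′ f inj₁ (λ _ → refl) gf)
  where
  f : Carrier (V ⊎ₛ ∅ₛ) → Carrier V
  f (inj₁ v) = v
  gf : ∀ x → inj₁ (f x) ≡ x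
  gf (inj₁ v) = refl

Σ-assocᵇ : ∀ (P : FinSet) (Q : Carrier P → FinSet)
             (R : (p : Carrier P) → Carrier (Q p) → FinSet)
         → Σₛ (Σₛ P Q) (uncurryᶠ {P} {Q} R) ≅ Σₛ P (λ p → Σₛ (Q p) (R p))
Σ-assocᵇ P Q R = bij (mk↔ₛ′ (λ { ((p , q) , r) → (p , (q , r)) })
                       (λ { (p , (q , r)) → ((p , q) , r) })
                       (λ _ → refl) (λ _ → refl))

Σ-oneᵇ : ∀ V → Σₛ 𝟙ₛ (λ _ → V) ≅ V
Σ-oneᵇ V = bij (mk↔ₛ′ proj₂ (tt ,_) (λ _ → refl) (λ _ → refl))

Σ-singletonsᵇ : ∀ P → Σₛ P (λ _ → 𝟙ₛ) ≅ P
Σ-singletonsᵇ P = bij (mk↔ₛ′ proj₁ (_, tt) (λ _ → refl) (λ _ → refl))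

Σ-⊎ᵇ : ∀ (P₁ P₂ : FinSet) (B₁ : Carrier P₁ → FinSet) (B₂ : Carrier P₂ → FinSet)
     → Σₛ (P₁ ⊎ₛ P₂) ([_,_]ᶠ {P₁} {P₂} B₁ B₂) ≅ (Σₛ P₁ B₁ ⊎ₛ Σₛ P₂ B₂)
Σ-⊎ᵇ P₁ P₂ B₁ B₂ = bij (mk↔ₛ′ f g fg gf)
  where
  f : Carrier (Σₛ (P₁ ⊎ₛ P₂) ([_,_]ᶠ {P₁} {P₂} B₁ B₂)) → Carrier (Σₛ P₁ B₁ ⊎ₛ Σₛ P₂ B₂)
  f (inj₁ p , b) = inj₁ (p , b)
  f (inj₂ p , b) = inj₂ (p , b)
  g : Carrier (Σₛ P₁ B₁ ⊎ₛ Σₛ P₂ B₂) → Carrier (Σₛ (P₁ ⊎ₛ P₂) ([_,_]ᶠ {P₁} {P₂} B₁ B₂))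
  g (inj₁ (p , b)) = inj₁ p , b
  g (inj₂ (p , b)) = inj₂ p , b
  fg : ∀ y → f (g y) ≡ y
  fg (inj₁ _) = refl
  fg (inj₂ _) = refl
  gf : ∀ x → g (f x) ≡ x
  gf (inj₁ p , b) = refl
  gf (inj₂ p , b) = refl

-- (M.1(O) ≅ M): V + (empty partition of the empty set)
unitʳ-Rᵇ : ∀ V → (V ⊎ₛ Σₛ ∅ₛ emptyFam) ≅ V
unitʳ-Rᵇ V = bij (mk↔ₛ′ f inj₁ (λ _ → refl) gf)
  where
  f : Carrier (V ⊎ₛ Σₛ ∅ₛ emptyFam) → Carrier V
  f (inj₁ v) = v
  gf : ∀ x → inj₁ (f x) ≡ x
  gf (inj₁ v) = refl

-- (1.M(X) ≅ M): empty set + partition of P into singletons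
unitˡ-Rᵇ : ∀ P → (∅ₛ ⊎ₛ Σₛ P (λ _ → 𝟙ₛ)) ≅ P
unitˡ-Rᵇ P = bij (mk↔ₛ′ f (λ p → inj₂ (p , tt)) (λ _ → refl) gf)
  where
  f : Carrier (∅ₛ ⊎ₛ Σₛ P (λ _ → 𝟙ₛ)) → Carrier P
  f (inj₂ (p , tt)) = p
  gf : ∀ x → inj₂ (f x , tt) ≡ x
  gf (inj₂ (p , tt)) = refl

ν-isoᵇ : ∀ V₁ V₂ → (V₁ ⊎ₛ Σₛ V₂ (λ _ → 𝟙ₛ)) ≅ (V₁ ⊎ₛ V₂)
ν-isoᵇ V₁ V₂ = bij (mk↔ₛ′ f g fg gf)
  where
  f : Carrier (V₁ ⊎ₛ Σₛ V₂ (λ _ → 𝟙ₛ)) → Carrier (V₁ ⊎ₛ V₂)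
  f (inj₁ v) = inj₁ v
  f (inj₂ (v , tt)) = inj₂ v
  g : Carrier (V₁ ⊎ₛ V₂) → Carrier (V₁ ⊎ₛ Σₛ V₂ (λ _ → 𝟙ₛ))
  g (inj₁ v) = inj₁ v
  g (inj₂ v) = inj₂ (v , tt)
  fg : ∀ y → f (g y) ≡ y
  fg (inj₁ v) = refl
  fg (inj₂ v) = refl
  gf : ∀ x → g (f x) ≡ x
  gf (inj₁ v) = refl
  gf (inj₂ (v , tt)) = refl

-- the associator of the Riordan category, on underlying label sets:
-- (V₁ + ⋃_{p∈P₂} B₂ p) + ⋃_{p∈P₃} ⋃_{q∈Q p} R p q
--   ≅ V₁ + ⋃ over the fine partition (P₂ + Σ P₃ Q) of its blocks
riordan-assocᵇ : ∀ (V₁ P₂ : FinSet) (B₂ : Carrier P₂ → FinSet) (P₃ : FinSet)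
                   (Q : Carrier P₃ → FinSet) (R : (p : Carrier P₃) → Carrier (Q p) → FinSet)
  → ((V₁ ⊎ₛ Σₛ P₂ B₂) ⊎ₛ Σₛ P₃ (λ p → Σₛ (Q p) (R p)))
    ≅ (V₁ ⊎ₛ Σₛ (P₂ ⊎ₛ Σₛ P₃ Q) ([_,_]ᶠ {P₂} {Σₛ P₃ Q} B₂ (uncurryᶠ {P₃} {Q} R)))
riordan-assocᵇ V₁ P₂ B₂ P₃ Q R = bij (mk↔ₛ′ f g fg gf)
  where
  A = Carrier ((V₁ ⊎ₛ Σₛ P₂ B₂) ⊎ₛ Σₛ P₃ (λ p → Σₛ (Q p) (R p)))
  C = Carrier (V₁ ⊎ₛ Σₛ (P₂ ⊎ₛ Σₛ P₃ Q) ([_,_]ᶠ {P₂} {Σₛ P₃ Q} B₂ (uncurryᶠ {P₃} {Q} R)))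
  f : A → C
  f (inj₁ (inj₁ v))       = inj₁ v
  f (inj₁ (inj₂ (p , b))) = inj₂ (inj₁ p , b)
  f (inj₂ (p , (q , r)))  = inj₂ (inj₂ (p , q) , r)
  g : C → A
  g (inj₁ v)                    = inj₁ (inj₁ v)
  g (inj₂ (inj₁ p , b))         = inj₁ (inj₂ (p , b))
  g (inj₂ (inj₂ (p , q) , r))   = inj₂ (p , (q , r))
  fg : ∀ y → f (g y) ≡ y
  fg (inj₁ v)                  = refl
  fg (inj₂ (inj₁ p , b))       = refl
  fg (inj₂ (inj₂ (p , q) , r)) = refl
  gf : ∀ x → g (f x) ≡ x
  gf (inj₁ (inj₁ v))       = refl
  gf (inj₁ (inj₂ (p , b))) = refl
  gf (inj₂ (p , (q , r)))  = refl

Σᵇ : ∀ {P P′ : FinSet} {B : Carrier P → FinSet} {B′ : Carrier P′ → FinSet}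
   → (γ : P ≅ P′) → ((p : Carrier P) → B p ≅ B′ (to γ p)) → Σₛ P B ≅ Σₛ P′ B′
Σᵇ {B = B} {B′} γ β = bij (Σ-↔ {A = λ p → Carrier (B p)} {B = λ p → Carrier (B′ p)} (iso γ) (λ {p} → iso (β p)))

-- A morphism M.N → K is given by its components
--   f : M[V₁] × N[V₂] → K[V₁ + V₂],
-- a morphism R(O) → K by its components
--   f : (assembly (a_p ∈ O[B p])_{p ∈ P}) × R[P] → K[⋃_p B p],
-- and a morphism M.M(O) → M by components
--   ρ : M[V] × (assembly over P) × M[P] → M[V + ⋃_p B p],
-- each natural in all the labels (this also expresses that the
-- components do not depend on the way the blocks are labelled).

ProdOp : Species → Set₁
ProdOp M = ∀ {V₁ V₂ : FinSet} → Str M V₁ → Str M V₂ → Str M (V₁ ⊎ₛ V₂)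

SubstOp : Species → Species → Species → Set₁
SubstOp R O K = ∀ {P : FinSet} {B : Carrier P → FinSet}
              → Assembly O P B → Str R P → Str K (Σₛ P B)

RiordanOp : Species → Species → Set₁
RiordanOp M O = ∀ {V P : FinSet} {B : Carrier P → FinSet}
              → Str M V → Assembly O P B → Str M P → Str M (V ⊎ₛ Σₛ P B)

AsmRel : ∀ (O : Species) {P P′ : FinSet} {B : Carrier P → FinSet} {B′ : Carrier P′ → FinSet}
       → (γ : P ≅ P′) → ((p : Carrier P) → B p ≅ B′ (to γ p))
       → Assembly O P B → Assembly O P′ B′ → Set
AsmRel O γ β a a′ = ∀ p → a′ (to γ p) ≡ tr O (β p) (a p)

ProdNatural : (M : Species) → ProdOp M → Set₁
ProdNatural M f = ∀ {V₁ V₁′ V₂ V₂′ : FinSet} (α : V₁ ≅ V₁′) (β : V₂ ≅ V₂′)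
                    (x : Str M V₁) (y : Str M V₂)
                → f (tr M α x) (tr M β y) ≡ tr M (α ⊎ᵇ β) (f x y)

SubstNatural : (R O K : Species) → SubstOp R O K → Set₁
SubstNatural R O K f =
  ∀ {P P′ : FinSet} {B : Carrier P → FinSet} {B′ : Carrier P′ → FinSet}
    (γ : P ≅ P′) (β : (p : Carrier P) → B p ≅ B′ (to γ p))
    (a : Assembly O P B) (a′ : Assembly O P′ B′) → AsmRel O γ β a a′
  → (r : Str R P) → f a′ (tr R γ r) ≡ tr K (Σᵇ γ β) (f a r)

RiordanNatural : (M O : Species) → RiordanOp M O → Set₁
RiordanNatural M O ρ =
  ∀ {V V′ P P′ : FinSet} {B : Carrier P → FinSet} {B′ : Carrier P′ → FinSet}
    (α : V ≅ V′) (γ : P ≅ P′) (β : (p : Carrier P) → B p ≅ B′ (to γ p))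
    (a : Assembly O P B) (a′ : Assembly O P′ B′) → AsmRel O γ β a a′
  → (m₁ : Str M V) (m₂ : Str M P)
  → ρ (tr M α m₁) a′ (tr M γ m₂) ≡ tr M (α ⊎ᵇ Σᵇ γ β) (ρ m₁ a m₂)

-- Monoids in (Sp, ., 1).  A morphism 1 → M is an element of M[∅].

record IsMonoid (M : Species) (ν : ProdOp M) (𝔢 : Str M ∅ₛ) : Set₁ where
  field
    ν-natural : ProdNatural M ν
    assoc     : ∀ {V₁ V₂ V₃ : FinSet} (x : Str M V₁) (y : Str M V₂) (z : Str M V₃)
              → tr M (⊎-assocᵇ V₁ V₂ V₃) (ν (ν x y) z) ≡ ν x (ν y z)
    identityˡ : ∀ {V : FinSet} (x : Str M V) → tr M (unitˡᵇ V) (ν 𝔢 x) ≡ x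
    identityʳ : ∀ {V : FinSet} (x : Str M V) → tr M (unitʳᵇ V) (ν x 𝔢) ≡ x

-- Operads: monoids in (Sp₊, substitution, X).  A morphism X → O is an
-- element of O[{*}].

record IsOperad (O : Species) (η : SubstOp O O O) (e : Str O 𝟙ₛ) : Set₁ where
  field
    positive  : Positive O
    η-natural : SubstNatural O O O η
    -- η ∘ η(O) = η ∘ O(η) (up to the associator O(O)(O) ≅ O(O(O)))
    assoc     : ∀ {P : FinSet} {Q : Carrier P → FinSet}
                  {R : (p : Carrier P) → Carrier (Q p) → FinSet}
                  (c : (p : Carrier P) (q : Carrier (Q p)) → Str O (R p q))
                  (b : Assembly O P Q) (a : Str O P)
              → tr O (Σ-assocᵇ P Q R) (η (asmΣ O {P} {Q} {R} c) (η b a))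
                ≡ η {B = λ p → Σₛ (Q p) (R p)} (λ p → η (c p) (b p)) a
    -- η ∘ O(e) = canonical iso O(X) ≅ O
    identityʳ : ∀ {P : FinSet} (a : Str O P)
              → tr O (Σ-singletonsᵇ P) (η (constAsm O P e) a) ≡ a
    -- η ∘ e(O) = canonical iso X(O) ≅ O
    identityˡ : ∀ {V : FinSet} (o : Str O V)
              → tr O (Σ-oneᵇ V) (η {B = λ _ → V} (λ _ → o) e) ≡ o

record IsRightModule (M O : Species) (η : SubstOp O O O) (e : Str O 𝟙ₛ)
                     (τ : SubstOp M O M) : Set₁ where
  field
    τ-natural : SubstNatural M O M τ
    assoc     : ∀ {P : FinSet} {Q : Carrier P → FinSet}
                  {R : (p : Carrier P) → Carrier (Q p) → FinSet}
                  (c : (p : Carrier P) (q : Carrier (Q p)) → Str O (R p q))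
                  (b : Assembly O P Q) (m : Str M P)
              → tr M (Σ-assocᵇ P Q R) (τ (asmΣ O {P} {Q} {R} c) (τ b m))
                ≡ τ {B = λ p → Σₛ (Q p) (R p)} (λ p → η (c p) (b p)) m
    identity  : ∀ {P : FinSet} (m : Str M P)
              → tr M (Σ-singletonsᵇ P) (τ (constAsm O P e) m) ≡ m

Compatible : (M O : Species) → ProdOp M → SubstOp M O M → Set₁
Compatible M O ν τ =
  ∀ {P₁ P₂ : FinSet} {B₁ : Carrier P₁ → FinSet} {B₂ : Carrier P₂ → FinSet}
    (a₁ : Assembly O P₁ B₁) (m₁ : Str M P₁) (a₂ : Assembly O P₂ B₂) (m₂ : Str M P₂)
  → ν (τ a₁ m₁) (τ a₂ m₂)
    ≡ tr M (Σ-⊎ᵇ P₁ P₂ B₁ B₂) (τ (asm⊎ O {P₁} {P₂} {B₁} {B₂} a₁ a₂) (ν m₁ m₂))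

-- Monops: monoids ((M,O),(ρ,η),(𝔢,e)) in the Riordan category Sp ⋊ Sp₊.
-- (A morphism (1,X) → (M,O) is a pair 𝔢 ∈ M[∅], e ∈ O[{*}].)

record IsMonop (M O : Species) (ρ : RiordanOp M O) (η : SubstOp O O O)
               (𝔢 : Str M ∅ₛ) (e : Str O 𝟙ₛ) : Set₁ where
  field
    positive  : Positive O
    ρ-natural : RiordanNatural M O ρ
    η-natural : SubstNatural O O O η
    -- associativity, M-component:
    --  ρ ∘ (ρ . M(η)) = ρ ∘ (M . ρ(O)) ∘ (associator)
    ρ-assoc   : ∀ {V₁ P₂ P₃ : FinSet} {B₂ : Carrier P₂ → FinSet}
                  {Q : Carrier P₃ → FinSet} {R : (p : Carrier P₃) → Carrier (Q p) → FinSet}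
                  (m₁ : Str M V₁) (a₂ : Assembly O P₂ B₂) (m₂ : Str M P₂)
                  (c : (p : Carrier P₃) (q : Carrier (Q p)) → Str O (R p q))
                  (b : Assembly O P₃ Q) (m₃ : Str M P₃)
              → tr M (riordan-assocᵇ V₁ P₂ B₂ P₃ Q R)
                   (ρ {B = λ p → Σₛ (Q p) (R p)} (ρ m₁ a₂ m₂) (λ p → η (c p) (b p)) m₃)
                ≡ ρ m₁ (asm⊎ O {P₂} {Σₛ P₃ Q} {B₂} {uncurryᶠ {P₃} {Q} R} a₂ (asmΣ O {P₃} {Q} {R} c))
                       (ρ m₂ b m₃)
    η-assoc   : ∀ {P : FinSet} {Q : Carrier P → FinSet}
                  {R : (p : Carrier P) → Carrier (Q p) → FinSet}
                  (c : (p : Carrier P) (q : Carrier (Q p)) → Str O (R p q))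
                  (b : Assembly O P Q) (a : Str O P)
              → tr O (Σ-assocᵇ P Q R) (η (asmΣ O {P} {Q} {R} c) (η b a))
                ≡ η {B = λ p → Σₛ (Q p) (R p)} (λ p → η (c p) (b p)) a
    -- left identity: (ρ,η) ∘ ((𝔢,e) * id) = canonical iso (1,X)*(M,O) ≅ (M,O)
    ρ-identityˡ : ∀ {P : FinSet} (m : Str M P)
                → tr M (unitˡ-Rᵇ P) (ρ 𝔢 (constAsm O P e) m) ≡ m
    η-identityˡ : ∀ {P : FinSet} (a : Str O P)
                → tr O (Σ-singletonsᵇ P) (η (constAsm O P e) a) ≡ a
    -- right identity: (ρ,η) ∘ (id * (𝔢,e)) = canonical iso (M,O)*(1,X) ≅ (M,O)
    ρ-identityʳ : ∀ {V : FinSet} (m : Str M V)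
                → tr M (unitʳ-Rᵇ V) (ρ m (emptyAsm O) 𝔢) ≡ m
    η-identityʳ : ∀ {V : FinSet} (o : Str O V)
                → tr O (Σ-oneᵇ V) (η {B = λ _ → V} (λ _ → o) e) ≡ o

ρ-of : (M O : Species) → ProdOp M → SubstOp M O M → RiordanOp M O
ρ-of M O ν τ m₁ a m₂ = ν m₁ (τ a m₂)

ν-of : (M O : Species) → RiordanOp M O → Str O 𝟙ₛ → ProdOp M
ν-of M O ρ e {V₁} {V₂} m₁ m₂ =
  tr M (ν-isoᵇ V₁ V₂) (ρ {B = λ _ → 𝟙ₛ} m₁ (constAsm O V₂ e) m₂)

τ-of : (M O : Species) → RiordanOp M O → Str M ∅ₛ → SubstOp M O M
τ-of M O ρ 𝔢 {P} {B} a m = tr M (unitˡᵇ (Σₛ P B)) (ρ 𝔢 a m)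

-- Associativity of ρ then
-- splits into associativity of ν, pseudo-associativity of τ and their compatibility,
-- each obtained by specialising some arguments of ρ-assoc to units and cancelling
-- them with the unit laws. Every such equation holds only up to a canonical
-- relabelling, so it is proved as a chain of relabellings x ≈[ σ ] y, whose composite
-- bijection is finally compared pointwise with the one in the statement.
module Submission where

open import Defs
open import Data.Product using (_×_; _,_)
open import Data.Sum using (inj₁; inj₂)
open import Relation.Binary.PropositionalEquality using (_≡_; refl; sym; trans; cong)
open import Function.Bundles using (Inverse; mk↔ₛ′)
open import Function.Construct.Symmetry using (↔-sym)

symᵇ : ∀ {V W} → V ≅ W → W ≅ V
symᵇ σ = bij (↔-sym (iso σ))

∅-Σᵇ : ∅ₛ ≅ Σₛ ∅ₛ emptyFam
∅-Σᵇ = bij (mk↔ₛ′ (λ ()) (λ { (() , _) }) (λ { (() , _) }) (λ ()))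

module Relabelling (S : Species) where

  infix 4 _≈[_]_
  _≈[_]_ : ∀ {V W} → Str S V → V ≅ W → Str S W → Set
  x ≈[ σ ] y = tr S σ x ≡ y

  ≈-refl : ∀ {V} {x : Str S V} → x ≈[ idᵇ V ] x
  ≈-refl = tr-id S _

  ≈-trans : ∀ {U V W} {σ : U ≅ V} {σ′ : V ≅ W} {x y z}
          → x ≈[ σ ] y → y ≈[ σ′ ] z → x ≈[ σ′ ∘ᵇ σ ] z
  ≈-trans {σ = σ} {σ′} {x} p q = trans (tr-∘ S σ σ′ x) (trans (cong (tr S σ′) p) q)

  ≈-ext : ∀ {V W} {σ σ′ : V ≅ W} {x y}
        → x ≈[ σ ] y → (∀ v → to σ v ≡ to σ′ v) → x ≈[ σ′ ] y
  ≈-ext {σ = σ} {σ′} {x} p σ≗σ′ = trans (sym (tr-cong S σ σ′ σ≗σ′ x)) p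

  ≈-sym : ∀ {V W} {σ : V ≅ W} {x y} → x ≈[ σ ] y → y ≈[ symᵇ σ ] x
  ≈-sym {σ = σ} {x} refl =
    trans (sym (tr-∘ S σ (symᵇ σ) x))
          (≈-ext ≈-refl (λ v → sym (Inverse.strictlyInverseʳ (iso σ) v)))

  module ≈-Reasoning where

    infix  3 _∎
    infixr 2 step-≈ step-≈˘

    step-≈ : ∀ {U V W} (x : Str S U) {y : Str S V} {z : Str S W} {σ : U ≅ V} {σ′ : V ≅ W}
           → y ≈[ σ′ ] z → x ≈[ σ ] y → x ≈[ σ′ ∘ᵇ σ ] z
    step-≈ _ q p = ≈-trans p q

    step-≈˘ : ∀ {U V W} (x : Str S U) {y : Str S V} {z : Str S W} {σ : V ≅ U} {σ′ : V ≅ W}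
            → y ≈[ σ′ ] z → y ≈[ σ ] x → x ≈[ σ′ ∘ᵇ symᵇ σ ] z
    step-≈˘ _ q p = ≈-trans (≈-sym p) q

    syntax step-≈  x q p = x ≈⟨  p ⟩ q
    syntax step-≈˘ x q p = x ≈˘⟨ p ⟩ q

    _∎ : ∀ {V} (x : Str S V) → x ≈[ idᵇ V ] x
    _ ∎ = ≈-refl

AsmRel-refl : ∀ (O : Species) {P : FinSet} {B : Carrier P → FinSet} (a : Assembly O P B)
            → AsmRel O (idᵇ P) (λ p → idᵇ (B p)) a a
AsmRel-refl O a p = sym (tr-id O (a p))

constAsm-rel : ∀ (O : Species) {P P′ : FinSet} (γ : P ≅ P′) (e : Str O 𝟙ₛ)
             → AsmRel O γ (λ _ → idᵇ 𝟙ₛ) (constAsm O P e) (constAsm O P′ e)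
constAsm-rel O γ e _ = sym (tr-id O e)

module ProdCong (M : Species) where
  open Relabelling M

  prod-cong : ∀ {ν : ProdOp M} → ProdNatural M ν
            → ∀ {V₁ V₁′ V₂ V₂′} {α : V₁ ≅ V₁′} {β : V₂ ≅ V₂′} {x x′ y y′}
            → x ≈[ α ] x′ → y ≈[ β ] y′ → ν x y ≈[ α ⊎ᵇ β ] ν x′ y′
  prod-cong natural {α = α} {β} {x} {y = y} refl refl = sym (natural α β x y)

module RiordanCong (M O : Species) where
  open Relabelling M

  riordan-cong : ∀ {ρ : RiordanOp M O} → RiordanNatural M O ρ
               → ∀ {V V′ P P′ : FinSet} {B : Carrier P → FinSet} {B′ : Carrier P′ → FinSet}
                   {α : V ≅ V′} {γ : P ≅ P′} {β : (p : Carrier P) → B p ≅ B′ (to γ p)}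
                   {a : Assembly O P B} {a′ : Assembly O P′ B′} {m₁ m₁′ m₂ m₂′}
               → m₁ ≈[ α ] m₁′ → AsmRel O γ β a a′ → m₂ ≈[ γ ] m₂′
               → ρ m₁ a m₂ ≈[ α ⊎ᵇ Σᵇ γ β ] ρ m₁′ a′ m₂′
  riordan-cong natural {α = α} {γ} {β} {a} {a′} {m₁} {m₂ = m₂} refl a~a′ refl =
    sym (natural α γ β a a′ a~a′ m₁ m₂)

module SubstCong (R O K : Species) where
  private
    module R = Relabelling R
    module K = Relabelling K

  subst-cong : ∀ {f : SubstOp R O K} → SubstNatural R O K f
             → ∀ {P P′ : FinSet} {B : Carrier P → FinSet} {B′ : Carrier P′ → FinSet}
                 {γ : P ≅ P′} {β : (p : Carrier P) → B p ≅ B′ (to γ p)}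
                 {a : Assembly O P B} {a′ : Assembly O P′ B′} {r r′}
             → AsmRel O γ β a a′ → r R.≈[ γ ] r′ → f a r K.≈[ Σᵇ γ β ] f a′ r′
  subst-cong natural {γ = γ} {β} {a} {a′} {r} a~a′ refl = sym (natural γ β a a′ a~a′ r)

module _ {M O : Species} {η : SubstOp O O O} {e : Str O 𝟙ₛ} {τ : SubstOp M O M}
         (isModule : IsRightModule M O η e τ) where
  open IsRightModule isModule
  open Relabelling M
  open ≈-Reasoning
  open SubstCong M O M

  τ-emptyAsm : (x : Str M ∅ₛ) → x ≈[ ∅-Σᵇ ] τ (emptyAsm O) x
  τ-emptyAsm x = ≈-ext
    (x                           ≈˘⟨ identity x ⟩
     τ (constAsm O ∅ₛ e) x      ≈⟨ subst-cong τ-natural {β = λ ()} (λ ()) ≈-refl ⟩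
     τ (emptyAsm O) x           ∎)
    (λ ())

module FromCompatibleModule
  {M O : Species} {ν : ProdOp M} {𝔢 : Str M ∅ₛ} {η : SubstOp O O O} {e : Str O 𝟙ₛ}
  {τ : SubstOp M O M}
  (isMonoid : IsMonoid M ν 𝔢) (isOperad : IsOperad O η e)
  (isModule : IsRightModule M O η e τ) (compatible : Compatible M O ν τ) where

  private
    module Mon = IsMonoid isMonoid
    module Opd = IsOperad isOperad
    module Mod = IsRightModule isModule
  open Relabelling M
  open ≈-Reasoning
  open ProdCong M
  open SubstCong M O M

  ρ : RiordanOp M O
  ρ = ρ-of M O ν τ

  ρ-natural : RiordanNatural M O ρ
  ρ-natural α γ β a a′ a~a′ m₁ m₂ =
    sym (prod-cong Mon.ν-natural refl (subst-cong Mod.τ-natural a~a′ refl))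

  ρ-assoc : ∀ {V₁ P₂ P₃ : FinSet} {B₂ : Carrier P₂ → FinSet}
              {Q : Carrier P₃ → FinSet} {R : (p : Carrier P₃) → Carrier (Q p) → FinSet}
              (m₁ : Str M V₁) (a₂ : Assembly O P₂ B₂) (m₂ : Str M P₂)
              (c : (p : Carrier P₃) (q : Carrier (Q p)) → Str O (R p q))
              (b : Assembly O P₃ Q) (m₃ : Str M P₃)
          → tr M (riordan-assocᵇ V₁ P₂ B₂ P₃ Q R)
               (ρ {B = λ p → Σₛ (Q p) (R p)} (ρ m₁ a₂ m₂) (λ p → η (c p) (b p)) m₃)
            ≡ ρ m₁ (asm⊎ O {P₂} {Σₛ P₃ Q} {B₂} {uncurryᶠ {P₃} {Q} R} a₂ (asmΣ O {P₃} {Q} {R} c))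
                   (ρ m₂ b m₃)
  ρ-assoc {P₃ = P₃} {B₂ = B₂} {Q} {R} m₁ a₂ m₂ c b m₃ = ≈-ext
    (ν (ν m₁ (τ a₂ m₂)) (τ {B = λ p → Σₛ (Q p) (R p)} (λ p → η (c p) (b p)) m₃)
       ≈˘⟨ prod-cong Mon.ν-natural ≈-refl (Mod.assoc c b m₃) ⟩
     ν (ν m₁ (τ a₂ m₂)) (τ c′ (τ b m₃))
       ≈⟨ Mon.assoc m₁ (τ a₂ m₂) (τ c′ (τ b m₃)) ⟩
     ν m₁ (ν (τ a₂ m₂) (τ c′ (τ b m₃)))
       ≈˘⟨ prod-cong Mon.ν-natural ≈-refl (sym (compatible a₂ m₂ c′ (τ b m₃))) ⟩
     ν m₁ (τ (asm⊎ O a₂ c′) (ν m₂ (τ b m₃)))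
       ∎)
    λ { (inj₁ (inj₁ _)) → refl ; (inj₁ (inj₂ _)) → refl ; (inj₂ _) → refl }
    where
    c′ : Assembly O (Σₛ P₃ Q) (uncurryᶠ {P₃} {Q} R)
    c′ = asmΣ O {P₃} {Q} {R} c

  ρ-identityˡ : ∀ {P : FinSet} (m : Str M P)
              → tr M (unitˡ-Rᵇ P) (ρ 𝔢 (constAsm O P e) m) ≡ m
  ρ-identityˡ {P} m = ≈-ext
    (ν 𝔢 (τ (constAsm O P e) m)   ≈⟨ Mon.identityˡ _ ⟩
     τ (constAsm O P e) m         ≈⟨ Mod.identity m ⟩
     m                            ∎)
    λ { (inj₂ _) → refl }

  ρ-identityʳ : ∀ {V : FinSet} (m : Str M V) → tr M (unitʳ-Rᵇ V) (ρ m (emptyAsm O) 𝔢) ≡ m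
  ρ-identityʳ m = ≈-ext
    (ν m (τ (emptyAsm O) 𝔢)   ≈˘⟨ prod-cong Mon.ν-natural ≈-refl (τ-emptyAsm isModule 𝔢) ⟩
     ν m 𝔢                    ≈⟨ Mon.identityʳ m ⟩
     m                        ∎)
    λ { (inj₁ _) → refl ; (inj₂ (() , _)) }

  isMonop : IsMonop M O ρ η 𝔢 e
  isMonop = record
    { positive    = Opd.positive
    ; ρ-natural   = ρ-natural
    ; η-natural   = Opd.η-natural
    ; ρ-assoc     = ρ-assoc
    ; η-assoc     = Opd.assoc
    ; ρ-identityˡ = ρ-identityˡ
    ; η-identityˡ = Opd.identityʳ
    ; ρ-identityʳ = ρ-identityʳ
    ; η-identityʳ = Opd.identityˡ
    }

module FromMonop
  {M O : Species} {ρ : RiordanOp M O} {η : SubstOp O O O} {𝔢 : Str M ∅ₛ} {e : Str O 𝟙ₛ}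
  (isMonop : IsMonop M O ρ η 𝔢 e) where

  private
    module Mp = IsMonop isMonop
  open Relabelling M
  open ≈-Reasoning
  open RiordanCong M O

  ν : ProdOp M
  ν = ν-of M O ρ e

  τ : SubstOp M O M
  τ = τ-of M O ρ 𝔢

  units : (P : FinSet) → Assembly O P (λ _ → 𝟙ₛ)
  units P = constAsm O P e

  ρ-as-ν : ∀ {V₁ V₂} (x : Str M V₁) (y : Str M V₂) → ρ x (units V₂) y ≈[ ν-isoᵇ V₁ V₂ ] ν x y
  ρ-as-ν x y = refl

  ρ-as-τ : ∀ {P : FinSet} {B : Carrier P → FinSet} (a : Assembly O P B) (m : Str M P)
         → ρ 𝔢 a m ≈[ unitˡᵇ (Σₛ P B) ] τ a m
  ρ-as-τ a m = refl

  isOperad : IsOperad O η e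
  isOperad = record
    { positive  = Mp.positive
    ; η-natural = Mp.η-natural
    ; assoc     = Mp.η-assoc
    ; identityʳ = Mp.η-identityˡ
    ; identityˡ = Mp.η-identityʳ
    }

  ν-natural : ProdNatural M ν
  ν-natural {V₂ = V₂} {V₂′} α β x y = sym (≈-ext
    (ν x y                                 ≈˘⟨ ρ-as-ν x y ⟩
     ρ x (units V₂) y                      ≈⟨ riordan-cong Mp.ρ-natural refl (constAsm-rel O β e) refl ⟩
     ρ (tr M α x) (units V₂′) (tr M β y)   ≈⟨ ρ-as-ν (tr M α x) (tr M β y) ⟩
     ν (tr M α x) (tr M β y)               ∎)
    λ { (inj₁ _) → refl ; (inj₂ _) → refl })

  ν-assoc : ∀ {V₁ V₂ V₃ : FinSet} (x : Str M V₁) (y : Str M V₂) (z : Str M V₃)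
          → tr M (⊎-assocᵇ V₁ V₂ V₃) (ν (ν x y) z) ≡ ν x (ν y z)
  ν-assoc {V₁} {V₂} {V₃} x y z = ≈-ext
    (ν (ν x y) z
       ≈˘⟨ ρ-as-ν (ν x y) z ⟩
     ρ (ν x y) (units V₃) z
       ≈˘⟨ riordan-cong Mp.ρ-natural (ρ-as-ν x y) (λ _ → sym (Mp.η-identityʳ e)) ≈-refl ⟩
     ρ (ρ x (units V₂) y) (λ _ → η (units 𝟙ₛ) e) z
       ≈⟨ Mp.ρ-assoc x (units V₂) y (λ _ _ → e) (units V₃) z ⟩
     ρ x units₂₃ (ρ y (units V₃) z)
       ≈⟨ riordan-cong Mp.ρ-natural ≈-refl units₂₃-rel (ρ-as-ν y z) ⟩
     ρ x (units (V₂ ⊎ₛ V₃)) (ν y z)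
       ≈⟨ ρ-as-ν x (ν y z) ⟩
     ν x (ν y z)
       ∎)
    λ { (inj₁ (inj₁ _)) → refl ; (inj₁ (inj₂ _)) → refl ; (inj₂ _) → refl }
    where
    units₂₃ = asm⊎ O {V₂} {Σₛ V₃ (λ _ → 𝟙ₛ)} {λ _ → 𝟙ₛ} {uncurryᶠ {V₃} {λ _ → 𝟙ₛ} (λ _ _ → 𝟙ₛ)}
                (units V₂) (asmΣ O {V₃} {λ _ → 𝟙ₛ} {λ _ _ → 𝟙ₛ} (λ _ _ → e))
    β : (p : Carrier (V₂ ⊎ₛ Σₛ V₃ (λ _ → 𝟙ₛ)))
      → [_,_]ᶠ {V₂} {Σₛ V₃ (λ _ → 𝟙ₛ)} (λ _ → 𝟙ₛ) (uncurryᶠ {V₃} {λ _ → 𝟙ₛ} (λ _ _ → 𝟙ₛ)) p ≅ 𝟙ₛ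
    β (inj₁ _) = idᵇ 𝟙ₛ
    β (inj₂ _) = idᵇ 𝟙ₛ
    units₂₃-rel : AsmRel O (ν-isoᵇ V₂ V₃) β units₂₃ (units (V₂ ⊎ₛ V₃))
    units₂₃-rel (inj₁ _) = sym (tr-id O e)
    units₂₃-rel (inj₂ _) = sym (tr-id O e)

  ν-identityˡ : ∀ {V : FinSet} (x : Str M V) → tr M (unitˡᵇ V) (ν 𝔢 x) ≡ x
  ν-identityˡ {V} x = ≈-ext
    (ν 𝔢 x              ≈˘⟨ ρ-as-ν 𝔢 x ⟩
     ρ 𝔢 (units V) x    ≈⟨ Mp.ρ-identityˡ x ⟩
     x                  ∎)
    λ { (inj₂ _) → refl }

  ν-identityʳ : ∀ {V : FinSet} (x : Str M V) → tr M (unitʳᵇ V) (ν x 𝔢) ≡ x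
  ν-identityʳ x = ≈-ext
    (ν x 𝔢                 ≈˘⟨ ρ-as-ν x 𝔢 ⟩
     ρ x (units ∅ₛ) 𝔢      ≈⟨ riordan-cong Mp.ρ-natural {β = λ ()} ≈-refl (λ ()) ≈-refl ⟩
     ρ x (emptyAsm O) 𝔢    ≈⟨ Mp.ρ-identityʳ x ⟩
     x                     ∎)
    λ { (inj₁ _) → refl }

  isMonoid : IsMonoid M ν 𝔢
  isMonoid = record
    { ν-natural = ν-natural
    ; assoc     = ν-assoc
    ; identityˡ = ν-identityˡ
    ; identityʳ = ν-identityʳ
    }

  τ-natural : SubstNatural M O M τ
  τ-natural γ β a a′ a~a′ r = sym (≈-ext
    (τ a r                ≈˘⟨ ρ-as-τ a r ⟩
     ρ 𝔢 a r              ≈⟨ riordan-cong Mp.ρ-natural ≈-refl a~a′ refl ⟩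
     ρ 𝔢 a′ (tr M γ r)    ≈⟨ ρ-as-τ a′ (tr M γ r) ⟩
     τ a′ (tr M γ r)      ∎)
    λ _ → refl)

  τ-assoc : ∀ {P : FinSet} {Q : Carrier P → FinSet}
              {R : (p : Carrier P) → Carrier (Q p) → FinSet}
              (c : (p : Carrier P) (q : Carrier (Q p)) → Str O (R p q))
              (b : Assembly O P Q) (m : Str M P)
          → tr M (Σ-assocᵇ P Q R) (τ (asmΣ O {P} {Q} {R} c) (τ b m))
            ≡ τ {B = λ p → Σₛ (Q p) (R p)} (λ p → η (c p) (b p)) m
  τ-assoc {P} {Q} {R} c b m = ≈-ext
    (τ c′ (τ b m)
       ≈˘⟨ ρ-as-τ c′ (τ b m) ⟩
     ρ 𝔢 c′ (τ b m)
       ≈˘⟨ riordan-cong Mp.ρ-natural ≈-refl c″-rel (ρ-as-τ b m) ⟩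
     ρ 𝔢 c″ (ρ 𝔢 b m)
       ≈˘⟨ Mp.ρ-assoc 𝔢 (emptyAsm O) 𝔢 c b m ⟩
     ρ (ρ 𝔢 (emptyAsm O) 𝔢) d m
       ≈⟨ riordan-cong Mp.ρ-natural (Mp.ρ-identityʳ 𝔢) (AsmRel-refl O {P} d) ≈-refl ⟩
     ρ 𝔢 d m
       ≈⟨ ρ-as-τ d m ⟩
     τ d m
       ∎)
    λ _ → refl
    where
    c′ = asmΣ O {P} {Q} {R} c
    c″ = asm⊎ O {∅ₛ} {Σₛ P Q} {emptyFam} {uncurryᶠ {P} {Q} R} (emptyAsm O) c′
    d : Assembly O P (λ p → Σₛ (Q p) (R p))
    d p = η (c p) (b p)
    β : (p : Carrier (∅ₛ ⊎ₛ Σₛ P Q))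
      → [_,_]ᶠ {∅ₛ} {Σₛ P Q} emptyFam (uncurryᶠ {P} {Q} R) p
        ≅ uncurryᶠ {P} {Q} R (to (unitˡᵇ (Σₛ P Q)) p)
    β (inj₂ _) = idᵇ _
    c″-rel : AsmRel O (unitˡᵇ (Σₛ P Q)) β c″ c′
    c″-rel (inj₂ _) = sym (tr-id O _)

  τ-identity : ∀ {P : FinSet} (m : Str M P)
             → tr M (Σ-singletonsᵇ P) (τ (units P) m) ≡ m
  τ-identity {P} m = ≈-ext
    (τ (units P) m        ≈˘⟨ ρ-as-τ (units P) m ⟩
     ρ 𝔢 (units P) m      ≈⟨ Mp.ρ-identityˡ m ⟩
     m                    ∎)
    λ _ → refl

  isModule : IsRightModule M O η e τ
  isModule = record { τ-natural = τ-natural ; assoc = τ-assoc ; identity = τ-identity }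

  compatible : Compatible M O ν τ
  -- ρ-assoc is used twice: once to absorb the units of ν into a₂ (η(a₂, e) = a₂),
  -- once to absorb the unit of τ (η(e, …, e ; a₂) = a₂).
  compatible {P₁} {P₂} {B₁} {B₂} a₁ m₁ a₂ m₂ = sym (≈-ext
    (τ (asm⊎ O a₁ a₂) (ν m₁ m₂)
       ≈˘⟨ ρ-as-τ (asm⊎ O a₁ a₂) (ν m₁ m₂) ⟩
     ρ 𝔢 (asm⊎ O a₁ a₂) (ν m₁ m₂)
       ≈˘⟨ riordan-cong Mp.ρ-natural ≈-refl a₁₂-rel (ρ-as-ν m₁ m₂) ⟩
     ρ 𝔢 a₁₂ (ρ m₁ (units P₂) m₂)
       ≈˘⟨ Mp.ρ-assoc 𝔢 a₁ m₁ (λ p _ → a₂ p) (units P₂) m₂ ⟩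
     ρ X₁ (λ p → η {B = λ _ → B₂ p} (λ _ → a₂ p) e) m₂
       ≈⟨ riordan-cong Mp.ρ-natural ≈-refl (λ p → sym (Mp.η-identityʳ (a₂ p))) ≈-refl ⟩
     ρ X₁ a₂ m₂
       ≈˘⟨ riordan-cong Mp.ρ-natural (Mp.ρ-identityʳ X₁) (λ p → sym (Mp.η-identityˡ (a₂ p))) ≈-refl ⟩
     ρ (ρ X₁ (emptyAsm O) 𝔢) (λ p → η (units (B₂ p)) (a₂ p)) m₂
       ≈⟨ Mp.ρ-assoc X₁ (emptyAsm O) 𝔢 (λ _ _ → e) a₂ m₂ ⟩
     ρ X₁ units₂ (ρ 𝔢 a₂ m₂)
       ≈⟨ riordan-cong Mp.ρ-natural (ρ-as-τ a₁ m₁) units₂-rel (ρ-as-τ a₂ m₂) ⟩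
     ρ (τ a₁ m₁) (units (Σₛ P₂ B₂)) (τ a₂ m₂)
       ≈⟨ ρ-as-ν (τ a₁ m₁) (τ a₂ m₂) ⟩
     ν (τ a₁ m₁) (τ a₂ m₂)
       ∎)
    λ { (inj₁ _ , _) → refl ; (inj₂ _ , _) → refl })
    where
    X₁ = ρ 𝔢 a₁ m₁
    a₁₂ = asm⊎ O {P₁} {Σₛ P₂ (λ _ → 𝟙ₛ)} {B₁} {uncurryᶠ {P₂} {λ _ → 𝟙ₛ} (λ p _ → B₂ p)}
            a₁ (asmΣ O {P₂} {λ _ → 𝟙ₛ} {λ p _ → B₂ p} (λ p _ → a₂ p))
    β₁₂ : (p : Carrier (P₁ ⊎ₛ Σₛ P₂ (λ _ → 𝟙ₛ)))
        → [_,_]ᶠ {P₁} {Σₛ P₂ (λ _ → 𝟙ₛ)} B₁ (uncurryᶠ {P₂} {λ _ → 𝟙ₛ} (λ p _ → B₂ p)) p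
          ≅ [_,_]ᶠ {P₁} {P₂} B₁ B₂ (to (ν-isoᵇ P₁ P₂) p)
    β₁₂ (inj₁ p) = idᵇ (B₁ p)
    β₁₂ (inj₂ (p , _)) = idᵇ (B₂ p)
    a₁₂-rel : AsmRel O (ν-isoᵇ P₁ P₂) β₁₂ a₁₂ (asm⊎ O {P₁} {P₂} {B₁} {B₂} a₁ a₂)
    a₁₂-rel (inj₁ p) = sym (tr-id O (a₁ p))
    a₁₂-rel (inj₂ (p , _)) = sym (tr-id O (a₂ p))
    units₂ = asm⊎ O {∅ₛ} {Σₛ P₂ B₂} {emptyFam} {uncurryᶠ {P₂} {B₂} (λ _ _ → 𝟙ₛ)}
               (emptyAsm O) (asmΣ O {P₂} {B₂} {λ _ _ → 𝟙ₛ} (λ _ _ → e))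
    β₂ : (p : Carrier (∅ₛ ⊎ₛ Σₛ P₂ B₂))
       → [_,_]ᶠ {∅ₛ} {Σₛ P₂ B₂} emptyFam (uncurryᶠ {P₂} {B₂} (λ _ _ → 𝟙ₛ)) p ≅ 𝟙ₛ
    β₂ (inj₂ _) = idᵇ 𝟙ₛ
    units₂-rel : AsmRel O (unitˡᵇ (Σₛ P₂ B₂)) β₂ units₂ (units (Σₛ P₂ B₂))
    units₂-rel (inj₂ _) = sym (tr-id O e)

  components : IsOperad O η e × IsMonoid M ν 𝔢 × IsRightModule M O η e τ × Compatible M O ν τ
  components = isOperad , isMonoid , isModule , compatible

theorem6p1 : (M O : Species)
    → ((ν : ProdOp M) (𝔢 : Str M ∅ₛ) (η : SubstOp O O O) (e : Str O 𝟙ₛ) (τ : SubstOp M O M)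
        → IsMonoid M ν 𝔢 → IsOperad O η e → IsRightModule M O η e τ → Compatible M O ν τ
        → IsMonop M O (ρ-of M O ν τ) η 𝔢 e)
    × ((ρ : RiordanOp M O) (η : SubstOp O O O) (𝔢 : Str M ∅ₛ) (e : Str O 𝟙ₛ)
        → IsMonop M O ρ η 𝔢 e
        → IsOperad O η e
          × IsMonoid M (ν-of M O ρ e) 𝔢
          × IsRightModule M O η e (τ-of M O ρ 𝔢)
          × Compatible M O (ν-of M O ρ e) (τ-of M O ρ 𝔢))
theorem6p1 M O =
    (λ _ _ _ _ _ → FromCompatibleModule.isMonop)
  , (λ _ _ _ _ → FromMonop.components)
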